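{- Let $G=(V,E)$ be a finite, simple, connected graph with $n\ge 2$ vertices and $m$ edges, and let $\mu=m-n+1$. Then $$\frac{1}{2}\left(\frac{\mu^2}{n-1}-\mu\right)\le \cap(G).$$
   Context: For a spanning tree $T=(V,E')$ of $G$, edges of $E'$ are tree-edges and edges of $E\setminus E'$ are cycle-edges; $uTv$ is the unique $u$–$v$ path in $T$. A cycle-edge $f=(v,w)$ determines the tree-cycle $vTw\cup\{f\}$. $\cap_G(T)$ is the number of unordered pairs of distinct cycle-edges whose tree-cycles share at least one edge. $\cap(G)$ (the intersection number of $G$) is the minimum of $\cap_G(T)$ over all spanning trees $T$ of $G$. -}

module Defs where

open import Data.Nat as ℕ using (ℕ; zero; suc; _≤_; _<_; _∸_; >-nonZero)
open import Data.Nat.Properties using (m<n⇒0<n∸m)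
open import Data.Integer as ℤ using (ℤ; +_)
open import Data.Rational as ℚ using (ℚ; ½; _/_)
open import Data.Fin as Fin using (Fin)
open import Data.Fin.Properties using ()
open import Data.Bool using (Bool; true)
open import Data.List using (List; []; _∷_; _++_; length)
open import Data.List.Relation.Unary.Unique.Propositional using (Unique)
open import Data.List.Membership.Propositional using (_∈_)
open import Data.Product using (Σ; ∃; ∃-syntax; _×_; _,_; proj₁; proj₂)
open import Data.Sum using (_⊎_)
open import Data.Unit using (⊤)
open import Function using (_⇔_)
open import Function.Definitions using (Injective)
open import Relation.Binary.PropositionalEquality using (_≡_; _≢_)
open import Relation.Nullary using (¬_)

-- Edge e joins (proj₁ (ends e)) and (proj₂ (ends e)); we store each edge
-- with its endpoints in increasing order (no loops), and distinct edge
-- indices have distinct endpoint pairs (no multi-edges).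

record SimpleGraph (n m : ℕ) : Set where
  field
    ends      : Fin m → Fin n × Fin n
    ordered   : ∀ e → proj₁ (ends e) Fin.< proj₂ (ends e)
    injective : Injective _≡_ _≡_ ends

open SimpleGraph public

module _ {n m : ℕ} (G : SimpleGraph n m) where

  Joins : Fin m → Fin n → Fin n → Set
  Joins e u v = ends G e ≡ (u , v) ⊎ ends G e ≡ (v , u)

  AdjIn : (Fin m → Set) → Fin n → Fin n → Set
  AdjIn S u v = ∃[ e ] (S e × Joins e u v)

data Walk {n : ℕ} (R : Fin n → Fin n → Set) : List (Fin n) → Fin n → Fin n → Set where
  [_]    : ∀ v → Walk R (v ∷ []) v v
  step   : ∀ u {v w vs} → R u v → Walk R (v ∷ vs) v w → Walk R (u ∷ v ∷ vs) u w

Path : {n : ℕ} (R : Fin n → Fin n → Set) → List (Fin n) → Fin n → Fin n → Set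
Path R vs u v = Walk R vs u v × Unique vs

Consecutive : {A : Set} → A → A → List A → Set
Consecutive x y vs = ∃[ as ] ∃[ bs ] (vs ≡ as ++ (x ∷ y ∷ bs))

module _ {n m : ℕ} (G : SimpleGraph n m) where

  AllEdges : Fin m → Set
  AllEdges _ = ⊤

  ConnectedBy : (Fin m → Set) → Set
  ConnectedBy S = ∀ u v → ∃[ vs ] Walk (AdjIn G S) vs u v

  Connected : Set
  Connected = ConnectedBy AllEdges

  HasCycle : (Fin m → Set) → Set
  HasCycle S = ∃[ vs ] ∃[ u ] ∃[ w ]
    (3 ≤ length vs × Path (AdjIn G S) vs u w × AdjIn G S w u)

  record SpanningTree : Set where
    field
      inT       : Fin m → Bool
      connected : ConnectedBy (λ e → inT e ≡ true)
      acyclic   : ¬ HasCycle (λ e → inT e ≡ true)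

  open SpanningTree public

  module _ (T : SpanningTree) where

    TreeEdge : Fin m → Set
    TreeEdge e = inT T e ≡ true

    CycleEdge : Fin m → Set
    CycleEdge e = ¬ TreeEdge e

    OnTreePath : Fin n → Fin n → Fin m → Set
    OnTreePath v w e = ∃[ vs ] (Path (AdjIn G TreeEdge) vs v w ×
                         ∃[ x ] ∃[ y ] (Consecutive x y vs × Joins G e x y))

    InTreeCycle : Fin m → Fin m → Set
    InTreeCycle f e = e ≡ f ⊎ OnTreePath (proj₁ (ends G f)) (proj₂ (ends G f)) e

    TreeCyclesMeet : Fin m → Fin m → Set
    TreeCyclesMeet f g = ∃[ e ] (InTreeCycle f e × InTreeCycle g e)

    -- unordered pairs {f,g} of distinct cycle-edges, represented by f < g
    IntersectingPair : Fin m → Fin m → Set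
    IntersectingPair f g = f Fin.< g × CycleEdge f × CycleEdge g × TreeCyclesMeet f g

    -- ∩_G(T) ≡ k : the set of intersecting pairs has exactly k elements
    -- (it is listed without repetition by a list of length k)
    IntersectionCount : ℕ → Set
    IntersectionCount k = ∃[ L ] (Unique L × length L ≡ k ×
      (∀ f g → ((f , g) ∈ L) ⇔ IntersectingPair f g))

  IntersectionNumber : ℕ → Set
  IntersectionNumber k =
    (∃[ T ] IntersectionCount T k) ×
    (∀ T k' → IntersectionCount T k' → k ≤ k')

cyclomatic : ℕ → ℕ → ℤ
cyclomatic n m = (+ m ℤ.- + n) ℤ.+ + 1

lowerBound : (n m : ℕ) → 2 ≤ n → ℚ
lowerBound n m 2≤n =
  ½ ℚ.* (((μ ℤ.* μ) / (n ∸ 1)) {{>-nonZero (m<n⇒0<n∸m 2≤n)}} ℚ.- (μ / 1))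
  where μ = cyclomatic n m

-- Every spanning tree T of G has exactly n − 1 edges: they are the parent edges of the non-root
-- vertices in a breadth-first tree, since a tree edge that is no parent edge would close a cycle
-- with the parent paths of its ends. Hence G has c ≥ μ cycle-edges. Classify each cycle-edge by
-- the first edge of its tree path; cycle-edges of the same class have intersecting tree-cycles,
-- so the class sizes c₁, …, c_{n−1} satisfy Σ cⱼ² ≤ 2 ∩_G(T) + c. Cauchy–Schwarz gives
-- c² ≤ (n − 1)(2 ∩_G(T) + c); the same then holds with μ ≤ c in place of c, which rearranges to
-- the bound. This works for every spanning tree, in particular for one attaining ∩(G).

module Submission where

open import Defs
open import Data.Bool using (true)
open import Data.Bool.Properties using () renaming (_≟_ to _≟ᵇ_)
open import Data.Empty using (⊥-elim)
open import Data.Fin as Fin using (Fin; zero; suc)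
import Data.Fin.Properties as Finₚ
open import Data.Integer as ℤ using (+_)
import Data.Integer.Properties as ℤₚ
open import Data.Integer.Tactic.RingSolver as ℤ-Ring using ()
open import Data.List using (List; []; _∷_; length; lookup; filter; map; allFin)
import Data.List.Properties as Listₚ
open import Data.List.Membership.Propositional using (_∈_)
open import Data.List.Membership.Propositional.Properties
  using (∈-lookup; ∈-filter⁺; ∈-filter⁻; ∈-map⁺; ∈-map⁻; ∈-allFin)
open import Data.List.Relation.Binary.Subset.Propositional using (_⊆_)
import Data.List.Relation.Unary.All as All
open import Data.List.Relation.Unary.All.Properties using (¬Any⇒All¬)
open import Data.List.Relation.Unary.AllPairs as AllPairs using (AllPairs; []; _∷_)
import Data.List.Relation.Unary.AllPairs.Properties as AllPairsₚ
open import Data.List.Relation.Unary.Any as Any using (here; there)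
open import Data.List.Relation.Unary.Any.Properties using (lookup-index)
open import Data.List.Relation.Unary.Unique.Propositional using (Unique)
import Data.List.Relation.Unary.Unique.Propositional.Properties as Uniqueₚ
open import Data.Nat using (ℕ; zero; suc; _+_; _*_; _∸_; _≤_; _<_; z≤n; s≤s)
open import Data.Nat.Properties
open import Data.Nat.Tactic.RingSolver using (solve-∀)
open import Data.Product using (Σ; ∃-syntax; _×_; _,_; proj₁; proj₂; swap; uncurry)
open import Data.Product.Properties using (,-injective; ≡-dec)
open import Data.Rational as ℚ using (ℚ; ½; _/_)
import Data.Rational.Properties as ℚₚ
open import Data.Rational.Unnormalised as ℚᵘ using (ℚᵘ; mkℚᵘ; *≤*)
import Data.Rational.Unnormalised.Properties as ℚᵘₚ
open import Data.Sum using (_⊎_; inj₁; inj₂; [_,_]′)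
open import Data.Vec.Functional using (removeAt)
open import Function using (_∘_; id)
open import Function.Bundles using (Equivalence)
open import Function.Definitions using (Injective)
open import Relation.Binary.Construct.Closure.ReflexiveTransitive as Star
  using (Star; ε; _◅_; _◅◅_)
open import Relation.Binary.PropositionalEquality
open import Relation.Nullary using (¬_; Dec; yes; no)
open import Relation.Nullary.Decidable using (_×-dec_; _⊎-dec_)
open import Relation.Unary using (Decidable)
open import Relation.Unary.Properties using (∁?)

open import Algebra.Properties.Semiring.Sum +-*-semiring
  using (sum; sum-cong-≗; sum-remove; sum-replicate-zero; *-distribˡ-sum; *-distribʳ-sum; ∑-distrib-+)

module _ {A : Set} where

  Unique⇒lookup-injective : ∀ {xs : List A} → Unique xs → ∀ i j → lookup xs i ≡ lookup xs j → i ≡ j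
  Unique⇒lookup-injective (_  ∷ _) zero    zero    _  = refl
  Unique⇒lookup-injective (x∉ ∷ _) zero    (suc j) eq = ⊥-elim (All.lookup x∉ (∈-lookup j) eq)
  Unique⇒lookup-injective (x∉ ∷ _) (suc i) zero    eq = ⊥-elim (All.lookup x∉ (∈-lookup i) (sym eq))
  Unique⇒lookup-injective (_  ∷ u) (suc i) (suc j) eq = cong suc (Unique⇒lookup-injective u i j eq)

  Unique∧⊆⇒length≤ : ∀ {xs ys : List A} → Unique xs → xs ⊆ ys → length xs ≤ length ys
  Unique∧⊆⇒length≤ {xs} {ys} unique xs⊆ys = Finₚ.injective⇒≤ position-injective
    where
    position : Fin (length xs) → Fin (length ys)
    position i = Any.index (xs⊆ys (∈-lookup i))

    position-injective : Injective _≡_ _≡_ position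
    position-injective {i} {j} eq = Unique⇒lookup-injective unique i j (begin
      lookup xs i            ≡⟨ lookup-index (xs⊆ys (∈-lookup i)) ⟩
      lookup ys (position i) ≡⟨ cong (lookup ys) eq ⟩
      lookup ys (position j) ≡⟨ lookup-index (xs⊆ys (∈-lookup j)) ⟨
      lookup xs j            ∎)
      where open ≡-Reasoning

  length-filter+length-filter-∁ : {P : A → Set} (P? : Decidable P) (xs : List A) →
    length (filter P? xs) + length (filter (∁? P?) xs) ≡ length xs
  length-filter+length-filter-∁ P? [] = refl
  length-filter+length-filter-∁ P? (x ∷ xs) with P? x
  ... | yes _ = cong suc (length-filter+length-filter-∁ P? xs)
  ... | no  _ = trans (+-suc _ _) (cong suc (length-filter+length-filter-∁ P? xs))

sum-const : ∀ n a → sum {n} (λ _ → a) ≡ n * a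
sum-const zero    a = refl
sum-const (suc n) a = cong (_+_ a) (sum-const n a)

sum-mono-≤ : ∀ {n} {f g : Fin n → ℕ} → (∀ i → f i ≤ g i) → sum f ≤ sum g
sum-mono-≤ {zero}  _   = z≤n
sum-mono-≤ {suc n} f≤g = +-mono-≤ (f≤g zero) (sum-mono-≤ (f≤g ∘ suc))

sum-update : ∀ {n} (i : Fin n) {f g : Fin n → ℕ} d → (∀ j → j ≢ i → f j ≡ g j) →
  f i ≡ d + g i → sum f ≡ d + sum g
sum-update {suc n} i {f} {g} d f≡g fi≡ = begin
  sum f                            ≡⟨ sum-remove f ⟩
  f i + sum (removeAt f i)         ≡⟨ cong₂ _+_ fi≡ (sum-cong-≗ (λ j → f≡g _ (Finₚ.punchInᵢ≢i i j))) ⟩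
  (d + g i) + sum (removeAt g i)   ≡⟨ +-assoc d (g i) _ ⟩
  d + (g i + sum (removeAt g i))   ≡⟨ cong (_+_ d) (sum-remove g) ⟨
  d + sum g                        ∎
  where open ≡-Reasoning

2ab≤a²+b² : ∀ a b → 2 * (a * b) ≤ a * a + b * b
2ab≤a²+b² a b = [ from-≤ , from-≥ ]′ (≤-total a b)
  where
  identity : ∀ x d → 2 * (x * (x + d)) + d * d ≡ x * x + (x + d) * (x + d)
  identity = solve-∀

  from-≤ : ∀ {x y} → x ≤ y → 2 * (x * y) ≤ x * x + y * y
  from-≤ {x} x≤y with m≤n⇒∃[o]m+o≡n x≤y
  ... | d , refl = subst (2 * (x * (x + d)) ≤_) (identity x d) (m≤m+n _ (d * d))

  from-≥ : b ≤ a → 2 * (a * b) ≤ a * a + b * b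
  from-≥ b≤a = subst₂ _≤_ (cong (_*_ 2) (*-comm b a)) (+-comm (b * b) (a * a)) (from-≤ b≤a)

cauchy-schwarz : ∀ n (c : Fin n → ℕ) → sum c * sum c ≤ n * sum (λ i → c i * c i)
cauchy-schwarz n c = *-cancelˡ-≤ 2 (begin
  2 * (S * S)                                    ≡⟨ double-sum-products ⟨
  sum (λ i → sum (λ j → 2 * (c i * c j)))        ≤⟨ sum-mono-≤ (λ i → sum-mono-≤ (λ j → 2ab≤a²+b² (c i) (c j))) ⟩
  sum (λ i → sum (λ j → c i * c i + c j * c j))  ≡⟨ double-sum-squares ⟩
  2 * (n * Q)                                    ∎)
  where
  open ≤-Reasoning
  S Q : ℕ
  S = sum c
  Q = sum (λ i → c i * c i)

  row-products : ∀ i → sum (λ j → 2 * (c i * c j)) ≡ (2 * c i) * S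
  row-products i = trans (sum-cong-≗ (λ j → sym (*-assoc 2 (c i) (c j)))) (sym (*-distribˡ-sum (2 * c i) c))

  row-squares : ∀ i → sum (λ j → c i * c i + c j * c j) ≡ n * (c i * c i) + Q
  row-squares i =
    trans (∑-distrib-+ {n} (λ _ → c i * c i) (λ j → c j * c j)) (cong (_+ Q) (sum-const n (c i * c i)))

  double-sum-products : sum (λ i → sum (λ j → 2 * (c i * c j))) ≡ 2 * (S * S)
  double-sum-products = begin-equality
    sum (λ i → sum (λ j → 2 * (c i * c j)))  ≡⟨ sum-cong-≗ row-products ⟩
    sum (λ i → (2 * c i) * S)               ≡⟨ *-distribʳ-sum S (λ i → 2 * c i) ⟨
    sum (λ i → 2 * c i) * S                 ≡⟨ cong (_* S) (*-distribˡ-sum 2 c) ⟨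
    (2 * S) * S                             ≡⟨ *-assoc 2 S S ⟩
    2 * (S * S)                             ∎

  double-sum-squares : sum (λ i → sum (λ j → c i * c i + c j * c j)) ≡ 2 * (n * Q)
  double-sum-squares = begin-equality
    sum (λ i → sum (λ j → c i * c i + c j * c j))  ≡⟨ sum-cong-≗ row-squares ⟩
    sum (λ i → n * (c i * c i) + Q)                ≡⟨ ∑-distrib-+ {n} (λ i → n * (c i * c i)) (λ _ → Q) ⟩
    sum (λ i → n * (c i * c i)) + sum {n} (λ _ → Q) ≡⟨ cong₂ _+_ (*-distribˡ-sum n (λ i → c i * c i)) (sym (sum-const n Q)) ⟨
    n * Q + n * Q                                  ≡⟨ cong (_+_ (n * Q)) (+-identityʳ (n * Q)) ⟨
    2 * (n * Q)                                    ∎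

module ClassSizes {M N : ℕ} (class : Fin M → Fin N) where

  size : Fin N → List (Fin M) → ℕ
  size j F = length (filter (λ x → class x Finₚ.≟ j) F)

  sumOfSquares : List (Fin M) → ℕ
  sumOfSquares F = sum (λ j → size j F * size j F)

  size-∷-other : ∀ x F j → j ≢ class x → size j (x ∷ F) ≡ size j F
  size-∷-other x F j j≢ = cong length (Listₚ.filter-reject (λ y → class y Finₚ.≟ j) (j≢ ∘ sym))

  size-∷-own : ∀ x F → size (class x) (x ∷ F) ≡ suc (size (class x) F)
  size-∷-own x F = cong length (Listₚ.filter-accept (λ y → class y Finₚ.≟ class x) refl)

  sum-size : ∀ F → sum (λ j → size j F) ≡ length F
  sum-size []      = sum-replicate-zero N
  sum-size (x ∷ F) = trans (sum-update (class x) 1 (size-∷-other x F) (size-∷-own x F)) (cong suc (sum-size F))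

  sumOfSquares-∷ : ∀ x F → let a = size (class x) F in sumOfSquares (x ∷ F) ≡ suc (2 * a) + sumOfSquares F
  sumOfSquares-∷ x F = sum-update (class x) _
    (λ j j≢ → cong₂ _*_ (size-∷-other x F j j≢) (size-∷-other x F j j≢))
    (trans (cong₂ _*_ (size-∷-own x F) (size-∷-own x F)) (square-suc (size (class x) F)))
    where
    square-suc : ∀ a → suc a * suc a ≡ suc (2 * a) + a * a
    square-suc = solve-∀

  startsAt? : ∀ x → Decidable (λ (p : Fin M × Fin M) → proj₁ p ≡ x)
  startsAt? x p = proj₁ p Finₚ.≟ x

  size≤|pairsStartingAt| : ∀ x F → Unique F → (L : List (Fin M × Fin M)) →
    (∀ {g} → g ∈ F → class x ≡ class g → (x , g) ∈ L) → size (class x) F ≤ length (filter (startsAt? x) L)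
  size≤|pairsStartingAt| x F unique L partner∈L =
    subst (_≤ length (filter (startsAt? x) L)) (Listₚ.length-map (x ,_) sameClass)
      (Unique∧⊆⇒length≤ (Uniqueₚ.map⁺ (proj₂ ∘ ,-injective) (Uniqueₚ.filter⁺ _ unique)) partners⊆)
    where
    sameClass : List (Fin M)
    sameClass = filter (λ y → class y Finₚ.≟ class x) F

    partners⊆ : map (x ,_) sameClass ⊆ filter (startsAt? x) L
    partners⊆ p∈ with ∈-map⁻ (x ,_) p∈
    ... | y , y∈ , refl with ∈-filter⁻ (λ y → class y Finₚ.≟ class x) {xs = F} y∈
    ...   | y∈F , same = ∈-filter⁺ (startsAt? x) (partner∈L y∈F (sym same)) refl

  -- Σⱼ |Fⱼ|² = |F| + 2·#{f < g in F of the same class}, and each such pair lies in L.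
  sumOfSquares≤ : ∀ F → AllPairs Fin._<_ F → (L : List (Fin M × Fin M)) → Unique L →
    (∀ {f g} → f ∈ F → g ∈ F → f Fin.< g → class f ≡ class g → (f , g) ∈ L) →
    sumOfSquares F ≤ 2 * length L + length F
  sumOfSquares≤ [] _ _ _ _ = ≤-trans (≤-reflexive (sum-replicate-zero N)) z≤n
  sumOfSquares≤ (x ∷ F) (x<F ∷ sorted) L unique sameClass∈L = begin
    sumOfSquares (x ∷ F)                             ≡⟨ sumOfSquares-∷ x F ⟩
    suc (2 * size (class x) F) + sumOfSquares F      ≤⟨ +-mono-≤ (s≤s (*-monoʳ-≤ 2 size≤|Lₓ|)) ih ⟩
    suc (2 * length Lₓ) + (2 * length L₋ + length F) ≡⟨ regroup (length Lₓ) (length L₋) (length F) ⟩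
    2 * (length Lₓ + length L₋) + suc (length F)     ≡⟨ cong (λ l → 2 * l + suc (length F)) |Lₓ|+|L₋| ⟩
    2 * length L + length (x ∷ F)                    ∎
    where
    open ≤-Reasoning
    Lₓ L₋ : List (Fin M × Fin M)
    Lₓ = filter (startsAt? x) L
    L₋ = filter (∁? (startsAt? x)) L

    x<f : ∀ {f} → f ∈ F → x Fin.< f
    x<f = All.lookup x<F

    size≤|Lₓ| : size (class x) F ≤ length Lₓ
    size≤|Lₓ| = size≤|pairsStartingAt| x F (AllPairs.map (λ x<y x≡y → Finₚ.<-irrefl x≡y x<y) sorted) L
      (λ g∈ same → sameClass∈L (here refl) (there g∈) (x<f g∈) same)

    ih : sumOfSquares F ≤ 2 * length L₋ + length F
    ih = sumOfSquares≤ F sorted L₋ (Uniqueₚ.filter⁺ _ unique) λ f∈ g∈ f<g same →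
      ∈-filter⁺ (∁? (startsAt? x)) (sameClass∈L (there f∈) (there g∈) f<g same)
        (λ f≡x → Finₚ.<-irrefl (sym f≡x) (x<f f∈))

    |Lₓ|+|L₋| : length Lₓ + length L₋ ≡ length L
    |Lₓ|+|L₋| = length-filter+length-filter-∁ (startsAt? x) L

    regroup : ∀ l₁ l₂ f → suc (2 * l₁) + (2 * l₂ + f) ≡ 2 * (l₁ + l₂) + suc f
    regroup = solve-∀

least-witness : {P : ℕ → Set} → (∀ k → Dec (P k)) → ∀ {k} → P k → ∃[ d ] (P d × (∀ j → P j → d ≤ j))
least-witness P? p with P? 0
... | yes p₀ = 0 , p₀ , λ _ _ → z≤n
least-witness P? {zero}  p | no ¬p₀ = ⊥-elim (¬p₀ p)
least-witness P? {suc k} p | no ¬p₀ with least-witness (P? ∘ suc) p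
... | d , pd , d-least = suc d , pd , λ where
  zero    p₀ → ⊥-elim (¬p₀ p₀)
  (suc j) pj → s≤s (d-least j pj)

module _ {n m : ℕ} (G : SimpleGraph n m) where

  ends-ordered : ∀ {e u v} → ends G e ≡ (u , v) → u Fin.< v
  ends-ordered {e} eq = subst (λ p → proj₁ p Fin.< proj₂ p) eq (ordered G e)

  Joins-sym : ∀ {e u v} → Joins G e u v → Joins G e v u
  Joins-sym (inj₁ eq) = inj₂ eq
  Joins-sym (inj₂ eq) = inj₁ eq

  AdjIn-sym : ∀ {S u v} → AdjIn G S u v → AdjIn G S v u
  AdjIn-sym (e , s , j) = e , s , Joins-sym j

  joins? : ∀ e u v → Dec (Joins G e u v)
  joins? e u v = ≡-dec Finₚ._≟_ Finₚ._≟_ (ends G e) (u , v) ⊎-dec ≡-dec Finₚ._≟_ Finₚ._≟_ (ends G e) (v , u)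

  Joins-irreflexive : ∀ {e u} → ¬ Joins G e u u
  Joins-irreflexive (inj₁ eq) = Finₚ.<-irrefl refl (ends-ordered eq)
  Joins-irreflexive (inj₂ eq) = Finₚ.<-irrefl refl (ends-ordered eq)

  Joins-unique : ∀ {e e′ u v} → Joins G e u v → Joins G e′ u v → e ≡ e′
  Joins-unique (inj₁ eq) (inj₁ eq′) = injective G (trans eq (sym eq′))
  Joins-unique (inj₂ eq) (inj₂ eq′) = injective G (trans eq (sym eq′))
  Joins-unique (inj₁ eq) (inj₂ eq′) = ⊥-elim (Finₚ.<-asym (ends-ordered eq) (ends-ordered eq′))
  Joins-unique (inj₂ eq) (inj₁ eq′) = ⊥-elim (Finₚ.<-asym (ends-ordered eq) (ends-ordered eq′))

  Joins-endpoints : ∀ {e a b c d} → Joins G e a b → Joins G e c d → (a ≡ c × b ≡ d) ⊎ (a ≡ d × b ≡ c)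
  Joins-endpoints (inj₁ p) (inj₁ q) = inj₁ (,-injective (trans (sym p) q))
  Joins-endpoints (inj₁ p) (inj₂ q) = inj₂ (,-injective (trans (sym p) q))
  Joins-endpoints (inj₂ p) (inj₁ q) = inj₂ (swap (,-injective (trans (sym p) q)))
  Joins-endpoints (inj₂ p) (inj₂ q) = inj₁ (swap (,-injective (trans (sym p) q)))

module _ {n : ℕ} {R : Fin n → Fin n → Set} where

  visits : ∀ {u v} → Star R u v → List (Fin n)
  visits ε                 = []
  visits (_◅_ {j = v} _ p) = v ∷ visits p

  Star⇒Walk : ∀ {u v} (p : Star R u v) → Walk R (u ∷ visits p) u v
  Star⇒Walk {u} ε       = [ u ]
  Star⇒Walk {u} (r ◅ p) = step u r (Star⇒Walk p)

  Walk⇒Star : ∀ {vs u v} → Walk R vs u v → Star R u v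
  Walk⇒Star [ _ ]        = ε
  Walk⇒Star (step _ r w) = r ◅ Walk⇒Star w

  open import Data.List.Membership.DecPropositional (Finₚ._≟_ {n}) using (_∈?_)

  suffix-from : ∀ {x u v} (p : Star R u v) → x ∈ u ∷ visits p → Unique (u ∷ visits p) →
    Σ (Star R x v) λ q → Unique (x ∷ visits q)
  suffix-from p       (here refl) unique       = p , unique
  suffix-from (_ ◅ p) (there x∈)  (_ ∷ unique) = suffix-from p x∈ unique

  loop-erase : ∀ {u v} → Star R u v → Σ (Star R u v) λ q → Unique (u ∷ visits q)
  loop-erase ε = ε , (All.[] ∷ [])
  loop-erase (_◅_ {i = u} {j = w} r p) with loop-erase p
  ... | q , unique with u ∈? (w ∷ visits q)
  ...   | yes u∈ = suffix-from q u∈ unique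
  ...   | no  u∉ = r ◅ q , (¬Any⇒All¬ _ u∉ ∷ unique)

visits-map : ∀ {n} {R R′ : Fin n → Fin n → Set} (f : ∀ {u v} → R u v → R′ u v) {u v} (p : Star R u v) →
  visits (Star.map f p) ≡ visits p
visits-map f ε                 = refl
visits-map f (_◅_ {j = v} _ p) = cong (v ∷_) (visits-map f p)

module RootedSpanningTree {N m : ℕ} (G : SimpleGraph (suc N) m) (T : SpanningTree G) where

  Vertex : Set
  Vertex = Fin (suc N)

  treeEdge? : Decidable (TreeEdge G T)
  treeEdge? e = inT T e ≟ᵇ true

  Adjᵀ : Vertex → Vertex → Set
  Adjᵀ = AdjIn G (TreeEdge G T)

  adjᵀ? : ∀ u v → Dec (Adjᵀ u v)
  adjᵀ? u v = Finₚ.any? (λ e → treeEdge? e ×-dec joins? G e u v)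

  ReachesRootWithin : ℕ → Vertex → Set
  ReachesRootWithin zero    v = v ≡ zero
  ReachesRootWithin (suc k) v = v ≡ zero ⊎ ∃[ w ] (Adjᵀ v w × ReachesRootWithin k w)

  reachesRootWithin? : ∀ k v → Dec (ReachesRootWithin k v)
  reachesRootWithin? zero    v = v Finₚ.≟ zero
  reachesRootWithin? (suc k) v = (v Finₚ.≟ zero) ⊎-dec Finₚ.any? (λ w → adjᵀ? v w ×-dec reachesRootWithin? k w)

  walk⇒reachesRootWithin : ∀ {v} → Star Adjᵀ v zero → ∃[ k ] ReachesRootWithin k v
  walk⇒reachesRootWithin ε       = 0 , refl
  walk⇒reachesRootWithin (r ◅ p) with walk⇒reachesRootWithin p
  ... | k , within = suc k , inj₂ (_ , r , within)

  least-depth : ∀ v → ∃[ d ] (ReachesRootWithin d v × (∀ j → ReachesRootWithin j v → d ≤ j))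
  least-depth v = least-witness (λ k → reachesRootWithin? k v)
    (proj₂ (walk⇒reachesRootWithin (Walk⇒Star (proj₂ (connected T v zero)))))

  depth : Vertex → ℕ
  depth v = proj₁ (least-depth v)

  record Parent (v : Vertex) : Set where
    field
      vertex     : Vertex
      edge       : Fin m
      isTreeEdge : TreeEdge G T edge
      joins      : Joins G edge v vertex
      closer     : depth vertex < depth v

  parent : ∀ v → v ≢ zero → Parent v
  parent v v≢0 = from-least (proj₂ (least-depth v)) refl
    where
    from-least : ∀ {d} → ReachesRootWithin d v × (∀ j → ReachesRootWithin j v → d ≤ j) → depth v ≡ d → Parent v
    from-least {zero}  (v≡0 , _)      _ = ⊥-elim (v≢0 v≡0)
    from-least {suc d} (inj₁ v≡0 , _) _ = ⊥-elim (v≢0 v≡0)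
    from-least {suc d} (inj₂ (w , (e , te , j) , w-within) , least) depth≡ = record
      { vertex = w ; edge = e ; isTreeEdge = te ; joins = j
      ; closer = subst (depth w <_) (sym depth≡) (s≤s (proj₂ (proj₂ (least-depth w)) d w-within))
      }

  parentOf : (i : Fin N) → Parent (suc i)
  parentOf i = parent (suc i) (λ ())

  parentEdge : Fin N → Fin m
  parentEdge = Parent.edge ∘ parentOf

  parentEdge-injective : Injective _≡_ _≡_ parentEdge
  parentEdge-injective {i} {j} eq
    with Joins-endpoints G (Parent.joins (parentOf i))
           (subst (λ e → Joins G e (suc j) (Parent.vertex (parentOf j))) (sym eq) (Parent.joins (parentOf j)))
  ... | inj₁ (si≡sj , _) = Finₚ.suc-injective si≡sj
  ... | inj₂ (si≡pj , pi≡sj) = ⊥-elim (<-asym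
    (subst (λ v → depth v < depth (suc i)) pi≡sj (Parent.closer (parentOf i)))
    (subst (λ v → depth v < depth (suc j)) (sym si≡pj) (Parent.closer (parentOf j))))

  AdjᵀAvoiding : Fin m → Vertex → Vertex → Set
  AdjᵀAvoiding e = AdjIn G (λ x → TreeEdge G T x × x ≢ e)

  walk-to-root-avoiding : ∀ {e} → (∀ i → parentEdge i ≢ e) → ∀ v → Star (AdjᵀAvoiding e) v zero
  walk-to-root-avoiding {e} avoid v = go (depth v) v ≤-refl
    where
    go : ∀ k u → depth u ≤ k → Star (AdjᵀAvoiding e) u zero
    go _       zero    _   = ε
    go zero    (suc i) d≤0 = ⊥-elim (n≮0 (<-≤-trans (Parent.closer (parentOf i)) d≤0))
    go (suc k) (suc i) d≤  =
      (parentEdge i , (Parent.isTreeEdge P , avoid i) , Parent.joins P) ◅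
      go k (Parent.vertex P) (≤-pred (<-≤-trans (Parent.closer P) d≤))
      where
      P : Parent (suc i)
      P = parentOf i

  -- The path has at least two edges because G is simple, so adding e closes a cycle.
  avoiding-path⇒HasCycle : ∀ {e a b} → TreeEdge G T e → Joins G e a b →
    (p : Star (AdjᵀAvoiding e) a b) → Unique (a ∷ visits p) → HasCycle G (TreeEdge G T)
  avoiding-path⇒HasCycle _ j ε _ = ⊥-elim (Joins-irreflexive G j)
  avoiding-path⇒HasCycle _ j ((_ , (_ , e′≢e) , j′) ◅ ε) _ = ⊥-elim (e′≢e (Joins-unique G j′ j))
  avoiding-path⇒HasCycle {e} {a} {b} te j p@(_ ◅ _ ◅ _) unique =
    a ∷ visits p′ , a , b , s≤s (s≤s (s≤s z≤n)) ,
    (Star⇒Walk p′ , subst (λ vs → Unique (a ∷ vs)) (sym (visits-map forget p)) unique) ,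
    (e , te , Joins-sym G j)
    where
    forget : ∀ {u v} → AdjᵀAvoiding e u v → Adjᵀ u v
    forget (x , (t , _) , jx) = x , t , jx
    p′ : Star Adjᵀ a b
    p′ = Star.map forget p

  parentEdge-onto : ∀ e → TreeEdge G T e → ∃[ i ] parentEdge i ≡ e
  parentEdge-onto e te with Finₚ.any? (λ i → parentEdge i Finₚ.≟ e)
  ... | yes found = found
  ... | no none = ⊥-elim (acyclic T (uncurry (avoiding-path⇒HasCycle te (inj₁ refl))
          (loop-erase (to-root (proj₁ (ends G e)) ◅◅ Star.reverse (AdjIn-sym G) (to-root (proj₂ (ends G e)))))))
    where
    to-root : ∀ v → Star (AdjᵀAvoiding e) v zero
    to-root = walk-to-root-avoiding (λ i eq → none (i , eq))

  treePath-parentEdge : ∀ {u v} → u ≢ v → ∃[ i ] OnTreePath G T u v (parentEdge i)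
  treePath-parentEdge {u} {v} u≢v with loop-erase (Walk⇒Star (proj₂ (connected T u v)))
  ... | ε , _ = ⊥-elim (u≢v refl)
  ... | (e , te , j) ◅ q , unique with parentEdge-onto e te
  ...   | i , refl = i , _ , (Star⇒Walk ((e , te , j) ◅ q) , unique) , u , _ , ([] , visits q , refl) , j

module CycleEdgeCount {N m : ℕ} (G : SimpleGraph (suc N) m) (T : SpanningTree G) where

  open RootedSpanningTree G T

  treeEdges cycleEdges : List (Fin m)
  treeEdges  = filter treeEdge? (allFin m)
  cycleEdges = filter (∁? treeEdge?) (allFin m)

  treeEdges-length≤ : length treeEdges ≤ N
  treeEdges-length≤ = begin
    length treeEdges                  ≤⟨ Unique∧⊆⇒length≤ (Uniqueₚ.filter⁺ treeEdge? (Uniqueₚ.allFin⁺ m)) treeEdges⊆ ⟩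
    length (map parentEdge (allFin N)) ≡⟨ trans (Listₚ.length-map parentEdge (allFin N)) (Listₚ.length-tabulate id) ⟩
    N                                 ∎
    where
    open ≤-Reasoning
    treeEdges⊆ : treeEdges ⊆ map parentEdge (allFin N)
    treeEdges⊆ e∈ with parentEdge-onto _ (proj₂ (∈-filter⁻ treeEdge? {xs = allFin m} e∈))
    ... | i , refl = ∈-map⁺ parentEdge (∈-allFin i)

  m≤N+|cycleEdges| : m ≤ N + length cycleEdges
  m≤N+|cycleEdges| = begin
    m                                       ≡⟨ trans (length-filter+length-filter-∁ treeEdge? (allFin m)) (Listₚ.length-tabulate id) ⟨
    length treeEdges + length cycleEdges    ≤⟨ +-monoˡ-≤ (length cycleEdges) treeEdges-length≤ ⟩
    N + length cycleEdges                   ∎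
    where open ≤-Reasoning

  -- A cycle-edge is classified by the first edge of its tree path, i.e. by the vertex whose parent edge that is.
  class : Fin m → Fin N
  class f = proj₁ (treePath-parentEdge (Finₚ.<⇒≢ (ordered G f)))

  class-onTreePath : ∀ f → OnTreePath G T (proj₁ (ends G f)) (proj₂ (ends G f)) (parentEdge (class f))
  class-onTreePath f = proj₂ (treePath-parentEdge (Finₚ.<⇒≢ (ordered G f)))

  sameClass⇒IntersectingPair : ∀ {f g} → CycleEdge G T f → CycleEdge G T g → f Fin.< g → class f ≡ class g →
    IntersectingPair G T f g
  sameClass⇒IntersectingPair {f} {g} cf cg f<g same =
    f<g , cf , cg , parentEdge (class f) , inj₂ (class-onTreePath f) ,
    inj₂ (subst (OnTreePath G T _ _ ∘ parentEdge) (sym same) (class-onTreePath g))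

  open ClassSizes class

  |cycleEdges|²≤ : ∀ {k} → IntersectionCount G T k →
    length cycleEdges * length cycleEdges ≤ N * (2 * k + length cycleEdges)
  |cycleEdges|²≤ (L , unique , refl , L-spec) = begin
    c * c                         ≡⟨ cong (λ x → x * x) (sum-size cycleEdges) ⟨
    sum sizes * sum sizes         ≤⟨ cauchy-schwarz N sizes ⟩
    N * sumOfSquares cycleEdges   ≤⟨ *-monoʳ-≤ N (sumOfSquares≤ cycleEdges sorted L unique sameClass∈L) ⟩
    N * (2 * length L + c)        ∎
    where
    open ≤-Reasoning
    c : ℕ
    c = length cycleEdges

    sizes : Fin N → ℕ
    sizes j = size j cycleEdges

    sorted : AllPairs Fin._<_ cycleEdges
    sorted = AllPairsₚ.filter⁺ (∁? treeEdge?) (AllPairsₚ.tabulate⁺-< id)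

    isCycleEdge : ∀ {f} → f ∈ cycleEdges → CycleEdge G T f
    isCycleEdge = proj₂ ∘ ∈-filter⁻ (∁? treeEdge?) {xs = allFin m}

    sameClass∈L : ∀ {f g} → f ∈ cycleEdges → g ∈ cycleEdges → f Fin.< g → class f ≡ class g → (f , g) ∈ L
    sameClass∈L {f} {g} f∈ g∈ f<g same =
      Equivalence.from (L-spec f g) (sameClass⇒IntersectingPair (isCycleEdge f∈) (isCycleEdge g∈) f<g same)

-- x ↦ x² − N x is nondecreasing for x ≥ N, and the claim is trivial for x ≤ N.
x²≤N[a+x]-downward : ∀ N a {x y} → x ≤ y → y * y ≤ N * (a + y) → x * x ≤ N * (a + x)
x²≤N[a+x]-downward N a {x} x≤y h with ≤-total x N | m≤n⇒∃[o]m+o≡n x≤y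
... | inj₁ x≤N | _      = ≤-trans (*-monoˡ-≤ x x≤N) (*-monoʳ-≤ N (m≤n+m x a))
... | inj₂ N≤x | δ , refl = +-cancelʳ-≤ (N * δ) _ _ (begin
  x * x + N * δ               ≤⟨ +-monoʳ-≤ (x * x) (*-monoˡ-≤ δ N≤2x+δ) ⟩
  x * x + (2 * x + δ) * δ     ≡⟨ square-+ x δ ⟩
  (x + δ) * (x + δ)           ≤⟨ h ⟩
  N * (a + (x + δ))           ≡⟨ distribute N a x δ ⟩
  N * (a + x) + N * δ         ∎)
  where
  open ≤-Reasoning
  N≤2x+δ : N ≤ 2 * x + δ
  N≤2x+δ = ≤-trans N≤x (≤-trans (m≤m+n x (x + 0)) (m≤m+n (2 * x) δ))
  square-+ : ∀ x δ → x * x + (2 * x + δ) * δ ≡ (x + δ) * (x + δ)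
  square-+ = solve-∀
  distribute : ∀ N a x δ → N * (a + (x + δ)) ≡ N * (a + x) + N * δ
  distribute = solve-∀

cyclomatic-+ : ∀ N μ → cyclomatic (suc N) (N + μ) ≡ + μ
cyclomatic-+ N μ = identity (+ N) (+ μ)
  where
  identity : ∀ n x → ((n ℤ.+ x) ℤ.- (+ 1 ℤ.+ n)) ℤ.+ + 1 ≡ x
  identity = ℤ-Ring.solve-∀

½[μ²/n-μ]≤k : ∀ N k μ → μ * μ ≤ suc N * (2 * k + μ) →
  ½ ℚ.* ((+ μ ℤ.* + μ) / suc N ℚ.- + μ / 1) ℚ.≤ + k / 1
½[μ²/n-μ]≤k N k μ h =
  ℚₚ.toℚᵘ-cancel-≤ (ℚᵘₚ.≤-respˡ-≃ (ℚᵘₚ.≃-sym toℚᵘ-lhs) (ℚᵘₚ.≤-respʳ-≃ (ℚᵘₚ.≃-sym (ℚₚ.toℚᵘ-fromℚᵘ (mkℚᵘ (+ k) 0)))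
    (*≤* cross-multiplied)))
  where
  q : ℚᵘ
  q = mkℚᵘ (+ 1) 1 ℚᵘ.* (mkℚᵘ (+ μ ℤ.* + μ) N ℚᵘ.- mkℚᵘ (+ μ) 0)

  X Y : ℚ
  X = (+ μ ℤ.* + μ) / suc N
  Y = + μ / 1

  toℚᵘ-lhs : ℚ.toℚᵘ (½ ℚ.* (X ℚ.- Y)) ℚᵘ.≃ q
  toℚᵘ-lhs = ℚᵘₚ.≃-trans (ℚₚ.toℚᵘ-homo-* ½ (X ℚ.- Y))
    (ℚᵘₚ.*-cong (ℚₚ.toℚᵘ-fromℚᵘ (mkℚᵘ (+ 1) 1))
      (ℚᵘₚ.≃-trans (ℚₚ.toℚᵘ-homo-+ X (ℚ.- Y))
        (ℚᵘₚ.+-cong (ℚₚ.toℚᵘ-fromℚᵘ (mkℚᵘ (+ μ ℤ.* + μ) N))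
          (ℚᵘₚ.≃-trans (ℚₚ.toℚᵘ-homo‿- Y) (ℚᵘₚ.-‿cong (ℚₚ.toℚᵘ-fromℚᵘ (mkℚᵘ (+ μ) 0)))))))

  h′ : μ * μ ≤ k * (2 * (suc N * 1)) + μ * suc N
  h′ = subst (μ * μ ≤_) (rearrange (suc N) k μ) h
    where
    rearrange : ∀ n k μ → n * (2 * k + μ) ≡ k * (2 * (n * 1)) + μ * n
    rearrange = solve-∀

  cross-multiplied : ℚᵘ.↥ q ℤ.* ℚᵘ.↧ (mkℚᵘ (+ k) 0) ℤ.≤ + k ℤ.* ℚᵘ.↧ q
  cross-multiplied = begin
    ℚᵘ.↥ q ℤ.* + 1                                      ≡⟨ numerator (+ μ) (+ suc N) ⟩
    + μ ℤ.* + μ ℤ.- + μ ℤ.* + suc N                     ≡⟨ cong₂ ℤ._-_ (ℤₚ.pos-* μ μ) (ℤₚ.pos-* μ (suc N)) ⟨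
    + (μ * μ) ℤ.- + (μ * suc N)                         ≤⟨ ℤₚ.+-monoˡ-≤ (ℤ.- + (μ * suc N)) (ℤ.+≤+ h′) ⟩
    + (k * (2 * (suc N * 1)) + μ * suc N) ℤ.- + (μ * suc N) ≡⟨ cancel (+ (k * (2 * (suc N * 1)))) (+ (μ * suc N)) ⟩
    + (k * (2 * (suc N * 1)))                           ≡⟨ ℤₚ.pos-* k _ ⟩
    + k ℤ.* ℚᵘ.↧ q                                      ∎
    where
    open ℤₚ.≤-Reasoning
    numerator : ∀ x n → (+ 1 ℤ.* ((x ℤ.* x) ℤ.* + 1 ℤ.+ (ℤ.- x) ℤ.* n)) ℤ.* + 1 ≡ x ℤ.* x ℤ.- x ℤ.* n
    numerator = ℤ-Ring.solve-∀
    cancel : ∀ a b → (a ℤ.+ b) ℤ.- b ≡ a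
    cancel = ℤ-Ring.solve-∀

theorem2 : (n m : ℕ) (2≤n : 2 ≤ n) (G : SimpleGraph n m) → Connected G →
    (k : ℕ) → IntersectionNumber G k → lowerBound n m 2≤n ℚ.≤ (+ k / 1)
theorem2 (suc (suc N)) m (s≤s (s≤s z≤n)) G _ k ((T , count) , _) =
  subst (λ z → ½ ℚ.* ((z ℤ.* z) / suc N ℚ.- z / 1) ℚ.≤ + k / 1) (sym μ-is-cyclomatic)
    (½[μ²/n-μ]≤k N k μ (x²≤N[a+x]-downward (suc N) (2 * k) μ≤|cycleEdges| (|cycleEdges|²≤ count)))
  where
  open CycleEdgeCount G T
  open RootedSpanningTree G T using (parentEdge-injective)

  μ : ℕ
  μ = m ∸ suc N

  μ≤|cycleEdges| : μ ≤ length cycleEdges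
  μ≤|cycleEdges| = m≤n+o⇒m∸n≤o m (suc N) m≤N+|cycleEdges|

  μ-is-cyclomatic : cyclomatic (suc (suc N)) m ≡ + μ
  μ-is-cyclomatic = subst (λ m′ → cyclomatic (suc (suc N)) m′ ≡ + μ)
    (m+[n∸m]≡n (Finₚ.injective⇒≤ parentEdge-injective)) (cyclomatic-+ (suc N) μ)
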